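{- Let $(\mathbf A_i)_{i\in I}$ be a family of MLUB-complete posets. Then the cartesian product $\prod_{i\in I}\mathbf A_i$ (with componentwise order) is an MLUB-complete poset, and for every nonempty subset $M$ of $\prod_{i\in I}\mathbf A_i$: (i) $\operatorname{Min}U(M)=\prod_{i\in I}\operatorname{Min}U_{\mathbf A_i}(\{m(i)\mid m\in M\})$; (ii) $\operatorname{Max}L(M)=\prod_{i\in I}\operatorname{Max}L_{\mathbf A_i}(\{m(i)\mid m\in M\})$, where $U,L$ on the left are computed in the product.
   Context: For a poset and $X$ a subset: $L(X)$, $U(X)$ are the sets of lower/upper bounds of $X$ (subscripts indicate the poset), $\operatorname{Max}X,\operatorname{Min}X$ the sets of maximal/minimal elements. A poset is MLUB-complete if for every nonempty subset $N$, every upper bound of $N$ lies above some minimal upper bound of $N$, and every lower bound of $N$ lies below some maximal lower bound of $N$. -}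

module Defs where

open import Level using (Level; _⊔_; suc)
open import Data.Product using (Σ; ∃; _×_; _,_; proj₁; proj₂)
open import Relation.Unary using (Pred; _∈_; _≐_; Satisfiable)
open import Relation.Binary.PropositionalEquality using (_≡_)
open import Relation.Binary.Bundles using (Poset)


module _ {a : Level} (P : Poset a a a) where
  open Poset P

  U : Pred Carrier a → Pred Carrier a
  U X u = ∀ x → x ∈ X → x ≤ u

  L : Pred Carrier a → Pred Carrier a
  L X l = ∀ x → x ∈ X → l ≤ x

  Min : Pred Carrier a → Pred Carrier a
  Min S m = m ∈ S × (∀ y → y ∈ S → y ≤ m → y ≈ m)

  Max : Pred Carrier a → Pred Carrier a
  Max S m = m ∈ S × (∀ y → y ∈ S → m ≤ y → y ≈ m)

  MLUBComplete : Set (suc a)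
  MLUBComplete = (N : Pred Carrier a) → Satisfiable N →
      (∀ u → u ∈ U N → ∃ λ m → m ∈ Min (U N) × m ≤ u)
    × (∀ l → l ∈ L N → ∃ λ m → m ∈ Max (L N) × l ≤ m)

module _ {a : Level} {I : Set a} (A : I → Poset a a a) where
  private
    C : Set a
    C = (i : I) → Poset.Carrier (A i)

  ΠPoset : Poset a a a
  ΠPoset = record
    { Carrier = C
    ; _≈_ = λ x y → ∀ i → Poset._≈_ (A i) (x i) (y i)
    ; _≤_ = λ x y → ∀ i → Poset._≤_ (A i) (x i) (y i)
    ; isPartialOrder = record
      { isPreorder = record
        { isEquivalence = record
          { refl = λ i → Poset.Eq.refl (A i)
          ; sym = λ p i → Poset.Eq.sym (A i) (p i)
          ; trans = λ p q i → Poset.Eq.trans (A i) (p i) (q i)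
          }
        ; reflexive = λ p i → Poset.reflexive (A i) (p i)
        ; trans = λ p q i → Poset.trans (A i) (p i) (q i)
        }
      ; antisym = λ p q i → Poset.antisym (A i) (p i) (q i)
      }
    }

  ΠSet : ((i : I) → Pred (Poset.Carrier (A i)) a) → Pred C a
  ΠSet S x = ∀ i → x i ∈ S i

  proj : Pred C a → (i : I) → Pred (Poset.Carrier (A i)) a
  proj M i y = ∃ λ m → m ∈ M × m i ≡ y

-- Upper bounds in a product are computed componentwise, and a product of sets
-- in which every element lies above a minimal one has exactly the products of
-- the minimal elements as its minimal elements (choose a minimal element below
-- each coordinate). The statements about lower bounds and maximal elements are
-- the same facts for the family of order duals.
{-# OPTIONS --safe #-}
module Submission where

open import Defs
open import Level using (Level)
open import Data.Product using (∃; _×_; _,_; proj₁; proj₂; swap)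
open import Function using (_∘_)
open import Relation.Unary using (Pred; _∈_; _⊆_; _≐_; Satisfiable)
open import Relation.Unary.Properties using (≐-sym; ≐-trans)
open import Relation.Binary.Bundles using (Poset)
open import Relation.Binary.PropositionalEquality using (refl)
import Relation.Binary.Construct.Flip.EqAndOrd as Flip

module _ {a : Level} (P : Poset a a a) where
  open Poset P

  MinDominated : Pred Carrier a → Set a
  MinDominated S = ∀ x → x ∈ S → ∃ λ m → m ∈ Min P S × m ≤ x

  Min-resp-≐ : {S T : Pred Carrier a} → S ≐ T → Min P S ≐ Min P T
  Min-resp-≐ (S⊆T , T⊆S) =
      (λ (m∈S , m-min) → S⊆T m∈S , λ y y∈T → m-min y (T⊆S y∈T))
    , (λ (m∈T , m-min) → T⊆S m∈T , λ y y∈S → m-min y (S⊆T y∈S))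

  MinDominated-resp-≐ : {S T : Pred Carrier a} → S ≐ T → MinDominated S → MinDominated T
  MinDominated-resp-≐ S≐T@(_ , T⊆S) dominated x x∈T =
    let m , m-min , m≤x = dominated x (T⊆S x∈T) in m , proj₁ (Min-resp-≐ S≐T) m-min , m≤x

  Min-resp-≈ : {S : Pred Carrier a} {m μ : Carrier} → m ∈ S → μ ∈ Min P S → μ ≈ m → m ∈ Min P S
  Min-resp-≈ m∈S (_ , μ-min) μ≈m =
    m∈S , λ y y∈S y≤m → Eq.trans (μ-min y y∈S (trans y≤m (reflexive (Eq.sym μ≈m)))) μ≈m

  MLUBComplete-flip : MLUBComplete P → MLUBComplete (Flip.poset P)
  MLUBComplete-flip complete N N≢∅ = swap (complete N N≢∅)

module _ {a : Level} {I : Set a} (A : I → Poset a a a) where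
  private
    P = ΠPoset A
    open Poset P using (Carrier; _≤_)

  U-Π : (M : Pred Carrier a) → U P M ≐ ΠSet A (λ i → U (A i) (proj A M i))
  U-Π M = U⊆ΠU , (λ u∈ΠU x x∈M i → u∈ΠU i (x i) (x , x∈M , refl))
    where
    U⊆ΠU : U P M ⊆ ΠSet A (λ i → U (A i) (proj A M i))
    U⊆ΠU u∈U i _ (x , x∈M , refl) = u∈U x x∈M i

  proj-Satisfiable : {M : Pred Carrier a} → Satisfiable M → ∀ i → Satisfiable (proj A M i)
  proj-Satisfiable (x , x∈M) i = x i , x , x∈M , refl

  ΠSet-Min⊆Min-ΠSet : (S : (i : I) → Pred (Poset.Carrier (A i)) a) →
    ΠSet A (λ i → Min (A i) (S i)) ⊆ Min P (ΠSet A S)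
  ΠSet-Min⊆Min-ΠSet S m-min =
    (λ i → proj₁ (m-min i)) , λ y y∈S y≤m i → proj₂ (m-min i) (y i) (y∈S i) (y≤m i)

  module _ {S : (i : I) → Pred (Poset.Carrier (A i)) a}
           (dominated : ∀ i → MinDominated (A i) (S i)) where

    ΠSet-Min-below : ∀ x → x ∈ ΠSet A S → ∃ λ μ → μ ∈ ΠSet A (λ i → Min (A i) (S i)) × μ ≤ x
    ΠSet-Min-below x x∈S =
      (λ i → proj₁ (below i)) , (λ i → proj₁ (proj₂ (below i))) , (λ i → proj₂ (proj₂ (below i)))
      where
      below : ∀ i → ∃ λ m → m ∈ Min (A i) (S i) × Poset._≤_ (A i) m (x i)
      below i = dominated i (x i) (x∈S i)

    ΠSet-MinDominated : MinDominated P (ΠSet A S)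
    ΠSet-MinDominated x x∈S =
      let μ , μ-min , μ≤x = ΠSet-Min-below x x∈S in μ , ΠSet-Min⊆Min-ΠSet S μ-min , μ≤x

    Min-ΠSet : Min P (ΠSet A S) ≐ ΠSet A (λ i → Min (A i) (S i))
    Min-ΠSet = Min⊆ΠSet-Min , ΠSet-Min⊆Min-ΠSet S
      where
      Min⊆ΠSet-Min : Min P (ΠSet A S) ⊆ ΠSet A (λ i → Min (A i) (S i))
      Min⊆ΠSet-Min {m} (m∈S , m-min) i =
        let μ , μ-min , μ≤m = ΠSet-Min-below m m∈S
            μ≈m = m-min μ (proj₁ (ΠSet-Min⊆Min-ΠSet S μ-min)) μ≤m
        in Min-resp-≈ (A i) (m∈S i) (μ-min i) (μ≈m i)

  module _ (complete : ∀ i → MLUBComplete (A i))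
           (M : Pred Carrier a) (M≢∅ : Satisfiable M) where
    private
      U-proj-MinDominated : ∀ i → MinDominated (A i) (U (A i) (proj A M i))
      U-proj-MinDominated i = proj₁ (complete i (proj A M i) (proj-Satisfiable M≢∅ i))

    U-MinDominated : MinDominated P (U P M)
    U-MinDominated = MinDominated-resp-≐ P (≐-sym (U-Π M)) (ΠSet-MinDominated U-proj-MinDominated)

    Min-U-Π : Min P (U P M) ≐ ΠSet A (λ i → Min (A i) (U (A i) (proj A M i)))
    Min-U-Π = ≐-trans (Min-resp-≐ P (U-Π M)) (Min-ΠSet U-proj-MinDominated)

lemma2p4 : {a : Level} {I : Set a} (A : I → Poset a a a) →
    ((i : I) → MLUBComplete (A i)) →
    MLUBComplete (ΠPoset A)
    × ((M : Pred ((i : I) → Poset.Carrier (A i)) a) → Satisfiable M →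
        (Min (ΠPoset A) (U (ΠPoset A) M)
          ≐ ΠSet A (λ i → Min (A i) (U (A i) (proj A M i))))
        × (Max (ΠPoset A) (L (ΠPoset A) M)
          ≐ ΠSet A (λ i → Max (A i) (L (A i) (proj A M i)))))
lemma2p4 {a} {I} A complete =
    (λ N N≢∅ → U-MinDominated A complete N N≢∅ , U-MinDominated Aᵒᵖ completeᵒᵖ N N≢∅)
  , (λ M M≢∅ → Min-U-Π A complete M M≢∅ , Min-U-Π Aᵒᵖ completeᵒᵖ M M≢∅)
  where
  -- On the duals, U, Min and ΠPoset reduce definitionally to L, Max and ΠPoset A.
  Aᵒᵖ : I → Poset a a a
  Aᵒᵖ = Flip.poset ∘ A

  completeᵒᵖ : (i : I) → MLUBComplete (Aᵒᵖ i)
  completeᵒᵖ i = MLUBComplete-flip (A i) (complete i)
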